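{- Let $x \in \mathbb{F}^*$, let $Z \subseteq \overline{\mathbb{F}}$ be a floating-point interval, and let $z \in Z$. Then $x$ is feasible for $Z$ if and only if either $x \otimes \mathrm{RD}(z/x) \in Z$ or $x \otimes \mathrm{RU}(z/x) \in Z$.
   Context: Floating-point format: integers $\beta \ge 2$, $p \ge 1$, $e_{\min} \le e_{\max}$. $\mathbb{F}^* = \{M\beta^{e-p+1} : M,e \in \mathbb{Z},\ 0<|M|<\beta^p,\ e_{\min}\le e\le e_{\max}\}$, $\mathbb{F} = \mathbb{F}^*\cup\{0\}$, $\overline{\mathbb{F}} = \mathbb{F}\cup\{ -\infty,+\infty\}$. $\mathrm{RD}(x) = \max\{y\in\overline{\mathbb{F}} : y \le x\}$, $\mathrm{RU}(x) = \min\{y \in \overline{\mathbb{F}} : y \ge x\}$. $\mathrm{fl}:\overline{\mathbb{R}}\to\overline{\mathbb{F}}$ is a fixed nondecreasing rounding function with $\mathrm{fl}(x)\in\{\mathrm{RD}(x),\mathrm{RU}(x)\}$ for all $x$; $x\otimes y = \mathrm{fl}(xy)$ whenever the extended-real product is defined. A floating-point interval is a set $X\cap\overline{\mathbb{F}}$ with $X$ an extended-real interval. $x$ is a floating-point factor of $z$ if $x\otimes y = z$ for some $y\in\overline{\mathbb{F}}$; $x$ is feasible for $Z$ if $x$ is a floating-point factor of some $z\in Z$.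
   Formalization: The rounding function fl is defined on the extended rationals rather than on $\overline{\mathbb{R}}$, and the interval X underlying each floating-point interval is likewise a set of extended rationals. -}

module Defs where

open import Data.Nat as ℕ using (ℕ; zero; suc)
open import Data.Integer as ℤ using (ℤ; +_; -[1+_]; ∣_∣)
open import Data.Rational as ℚ using (ℚ; 0ℚ; 1ℚ)
open import Data.Product using (Σ; _×_; _,_)
open import Data.Sum using (_⊎_)
open import Relation.Nullary using (yes; no)
open import Relation.Binary.PropositionalEquality using (_≡_)

record Format : Set where
  field
    β : ℕ
    p : ℕ
    emin : ℤ
    emax : ℤ
    β≥2 : 2 ℕ.≤ β
    p≥1 : 1 ℕ.≤ p
    emin≤emax : emin ℤ.≤ emax

_^ℕ_ : ℚ → ℕ → ℚ
q ^ℕ zero = 1ℚ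
q ^ℕ suc n = q ℚ.* (q ^ℕ n)

-- q ^ k for k : ℤ (the case q^n = 0 with negative k never arises for q = β ≥ 2;
-- it is given the junk value 0).
_^ℤ_ : ℚ → ℤ → ℚ
q ^ℤ (+ n) = q ^ℕ n
q ^ℤ -[1+ n ] with (q ^ℕ suc n) ℚ.≟ 0ℚ
... | yes _ = 0ℚ
... | no r≢0 = ℚ.1/_ (q ^ℕ suc n) {{ℚ.≢-nonZero r≢0}}

-- Extended rationals (all floating-point numbers, their products and
-- quotients are extended rationals).
data ℚ̄ : Set where
  -∞ : ℚ̄
  fin : ℚ → ℚ̄
  +∞ : ℚ̄

data _≤ᵉ_ : ℚ̄ → ℚ̄ → Set where
  -∞≤ : ∀ {a} → -∞ ≤ᵉ a
  ≤+∞ : ∀ {a} → a ≤ᵉ +∞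
  fin≤ : ∀ {q r} → q ℚ.≤ r → fin q ≤ᵉ fin r

-- Product x * a of a rational x with an extended rational a.
-- (x * ±∞ for x = 0 is undefined; junk value 0 — only used with x ≠ 0.)
_⊛_ : ℚ → ℚ̄ → ℚ̄
x ⊛ fin r = fin (x ℚ.* r)
x ⊛ +∞ with 0ℚ ℚ.<? x | x ℚ.<? 0ℚ
... | yes _ | _ = +∞
... | no _ | yes _ = -∞
... | no _ | no _ = fin 0ℚ
x ⊛ -∞ with 0ℚ ℚ.<? x | x ℚ.<? 0ℚ
... | yes _ | _ = -∞
... | no _ | yes _ = +∞
... | no _ | no _ = fin 0ℚ

_/ᵉ_ : ℚ̄ → (x : ℚ) → .{{_ : ℚ.NonZero x}} → ℚ̄
z /ᵉ x = (ℚ.1/ x) ⊛ z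

module _ (fmt : Format) where
  open Format fmt

  InF* : ℚ → Set
  InF* q = Σ ℤ λ M → Σ ℤ λ e →
    (0 ℕ.< ∣ M ∣) × (∣ M ∣ ℕ.< β ℕ.^ p) × (emin ℤ.≤ e) × (e ℤ.≤ emax) ×
    (q ≡ (M ℚ./ 1) ℚ.* ((+ β ℚ./ 1) ^ℤ (e ℤ.- + p ℤ.+ + 1)))

  InF : ℚ → Set
  InF q = (q ≡ 0ℚ) ⊎ InF* q

  data InF̄ : ℚ̄ → Set where
    -∞∈ : InF̄ -∞
    +∞∈ : InF̄ +∞
    fin∈ : ∀ {q} → InF q → InF̄ (fin q)

  IsRD : ℚ̄ → ℚ̄ → Set
  IsRD a y = InF̄ y × (y ≤ᵉ a) × (∀ w → InF̄ w → w ≤ᵉ a → w ≤ᵉ y)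

  IsRU : ℚ̄ → ℚ̄ → Set
  IsRU a y = InF̄ y × (a ≤ᵉ y) × (∀ w → InF̄ w → a ≤ᵉ w → y ≤ᵉ w)

  record IsRounding (fl : ℚ̄ → ℚ̄) : Set where
    field
      mono : ∀ a b → a ≤ᵉ b → fl a ≤ᵉ fl b
      rd-or-ru : ∀ a → IsRD a (fl a) ⊎ IsRU a (fl a)

  IsInterval : (ℚ̄ → Set) → Set
  IsInterval X = ∀ a b c → X a → X c → a ≤ᵉ b → b ≤ᵉ c → X b

  IsFPInterval : (ℚ̄ → Set) → Set₁
  IsFPInterval Z = Σ (ℚ̄ → Set) λ X → IsInterval X ×
    (∀ w → (Z w → X w × InF̄ w) × (X w × InF̄ w → Z w))

  module _ (fl : ℚ̄ → ℚ̄) where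
    _⊗_ : ℚ → ℚ̄ → ℚ̄
    x ⊗ y = fl (x ⊛ y)

    IsFactor : ℚ → ℚ̄ → Set
    IsFactor x z = Σ ℚ̄ λ y → InF̄ y × (x ⊗ y ≡ z)

    Feasible : ℚ → (ℚ̄ → Set) → Set
    Feasible x Z = Σ ℚ̄ λ z → Z z × IsFactor x z

{-# OPTIONS --safe #-}
-- For x ≠ 0, y ↦ x ⊗ y is monotone or antitone and x ⊗ (z / x) = fl z = z.
-- If x ⊗ y ∈ Z with y ≤ z / x, then y ≤ RD(z / x) ≤ z / x since y ∈ F̄, so
-- x ⊗ RD(z / x) lies between x ⊗ y and z; being a floating-point number it is
-- in Z by convexity. The case y ≥ z / x is symmetric with RU.
module Submission where

open import Defs
open import Data.Rational using (ℚ; NonZero)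
open import Data.Sum using (_⊎_)
open import Data.Product using (_×_)

open import Data.Integer using (+[1+_]; -[1+_])
open import Data.Rational as ℚ using (mkℚ; 0ℚ; Positive; Negative; 1/_; _*_)
open import Data.Rational.Properties as ℚ
  using (positive⁻¹; negative⁻¹; 1/pos⇒pos; 1/neg⇒neg; pos⇒nonNeg; neg⇒nonPos)
open import Data.Sum using (inj₁; inj₂)
open import Data.Product using (_,_; proj₁; proj₂)
open import Data.Empty using (⊥-elim)
open import Relation.Nullary using (yes; no)
open import Relation.Binary.PropositionalEquality

≤ᵉ-refl : ∀ {a} → a ≤ᵉ a
≤ᵉ-refl { -∞} = -∞≤
≤ᵉ-refl {fin q} = fin≤ ℚ.≤-refl
≤ᵉ-refl {+∞} = ≤+∞

≤ᵉ-antisym : ∀ {a b} → a ≤ᵉ b → b ≤ᵉ a → a ≡ b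
≤ᵉ-antisym -∞≤ -∞≤ = refl
≤ᵉ-antisym ≤+∞ ≤+∞ = refl
≤ᵉ-antisym (fin≤ p) (fin≤ q) = cong fin (ℚ.≤-antisym p q)

≤ᵉ-total : ∀ a b → a ≤ᵉ b ⊎ b ≤ᵉ a
≤ᵉ-total -∞ b = inj₁ -∞≤
≤ᵉ-total a +∞ = inj₁ ≤+∞
≤ᵉ-total +∞ b = inj₂ ≤+∞
≤ᵉ-total a -∞ = inj₂ -∞≤
≤ᵉ-total (fin q) (fin r) with ℚ.≤-total q r
... | inj₁ q≤r = inj₁ (fin≤ q≤r)
... | inj₂ r≤q = inj₂ (fin≤ r≤q)

Between : ℚ̄ → ℚ̄ → ℚ̄ → Set
Between a b c = (a ≤ᵉ b × b ≤ᵉ c) ⊎ (c ≤ᵉ b × b ≤ᵉ a)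

pos⊛+∞ : ∀ x .{{_ : Positive x}} → x ⊛ +∞ ≡ +∞
pos⊛+∞ x with 0ℚ ℚ.<? x
... | yes _ = refl
... | no x≯0 = ⊥-elim (x≯0 (positive⁻¹ x))

pos⊛-∞ : ∀ x .{{_ : Positive x}} → x ⊛ -∞ ≡ -∞
pos⊛-∞ x with 0ℚ ℚ.<? x
... | yes _ = refl
... | no x≯0 = ⊥-elim (x≯0 (positive⁻¹ x))

neg⊛+∞ : ∀ x .{{_ : Negative x}} → x ⊛ +∞ ≡ -∞
neg⊛+∞ x with 0ℚ ℚ.<? x | x ℚ.<? 0ℚ
... | yes x>0 | _ = ⊥-elim (ℚ.<-asym x>0 (negative⁻¹ x))
... | no _ | yes _ = refl
... | no _ | no x≮0 = ⊥-elim (x≮0 (negative⁻¹ x))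

neg⊛-∞ : ∀ x .{{_ : Negative x}} → x ⊛ -∞ ≡ +∞
neg⊛-∞ x with 0ℚ ℚ.<? x | x ℚ.<? 0ℚ
... | yes x>0 | _ = ⊥-elim (ℚ.<-asym x>0 (negative⁻¹ x))
... | no _ | yes _ = refl
... | no _ | no x≮0 = ⊥-elim (x≮0 (negative⁻¹ x))

⊛-monoʳ-≤ᵉ-pos : ∀ x .{{_ : Positive x}} {a b} → a ≤ᵉ b → (x ⊛ a) ≤ᵉ (x ⊛ b)
⊛-monoʳ-≤ᵉ-pos x {b = b} -∞≤ = subst (_≤ᵉ (x ⊛ b)) (sym (pos⊛-∞ x)) -∞≤
⊛-monoʳ-≤ᵉ-pos x {a} ≤+∞ = subst ((x ⊛ a) ≤ᵉ_) (sym (pos⊛+∞ x)) ≤+∞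
⊛-monoʳ-≤ᵉ-pos x (fin≤ q≤r) = fin≤ (ℚ.*-monoˡ-≤-nonNeg x {{pos⇒nonNeg x}} q≤r)

⊛-monoʳ-≤ᵉ-neg : ∀ x .{{_ : Negative x}} {a b} → a ≤ᵉ b → (x ⊛ b) ≤ᵉ (x ⊛ a)
⊛-monoʳ-≤ᵉ-neg x {b = b} -∞≤ = subst ((x ⊛ b) ≤ᵉ_) (sym (neg⊛-∞ x)) ≤+∞
⊛-monoʳ-≤ᵉ-neg x {a} ≤+∞ = subst (_≤ᵉ (x ⊛ a)) (sym (neg⊛+∞ x)) -∞≤
⊛-monoʳ-≤ᵉ-neg x (fin≤ q≤r) = fin≤ (ℚ.*-monoˡ-≤-nonPos x {{neg⇒nonPos x}} q≤r)

⊛-preserves-Between : ∀ x .{{_ : NonZero x}} {a b c} → a ≤ᵉ b → b ≤ᵉ c →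
  Between (x ⊛ a) (x ⊛ b) (x ⊛ c)
⊛-preserves-Between x@(mkℚ +[1+ _ ] _ _) a≤b b≤c =
  inj₁ (⊛-monoʳ-≤ᵉ-pos x a≤b , ⊛-monoʳ-≤ᵉ-pos x b≤c)
⊛-preserves-Between x@(mkℚ -[1+ _ ] _ _) a≤b b≤c =
  inj₂ (⊛-monoʳ-≤ᵉ-neg x b≤c , ⊛-monoʳ-≤ᵉ-neg x a≤b)

*-1/-cancelˡ : ∀ x .{{_ : NonZero x}} q → x * (1/ x * q) ≡ q
*-1/-cancelˡ x q = begin
  x * (1/ x * q)  ≡⟨ ℚ.*-assoc x (1/ x) q ⟨
  x * 1/ x * q    ≡⟨ cong (_* q) (ℚ.*-inverseʳ x) ⟩
  ℚ.1ℚ * q        ≡⟨ ℚ.*-identityˡ q ⟩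
  q               ∎
  where open ≡-Reasoning

⊛-/ᵉ-inverse : ∀ x .{{_ : NonZero x}} z → x ⊛ (z /ᵉ x) ≡ z
⊛-/ᵉ-inverse x (fin q) = cong fin (*-1/-cancelˡ x q)
⊛-/ᵉ-inverse x@(mkℚ +[1+ _ ] _ _) +∞
  rewrite pos⊛+∞ (1/ x) {{1/pos⇒pos x}} = pos⊛+∞ x
⊛-/ᵉ-inverse x@(mkℚ +[1+ _ ] _ _) -∞
  rewrite pos⊛-∞ (1/ x) {{1/pos⇒pos x}} = pos⊛-∞ x
⊛-/ᵉ-inverse x@(mkℚ -[1+ _ ] _ _) +∞
  rewrite neg⊛+∞ (1/ x) {{1/neg⇒neg x}} = neg⊛-∞ x
⊛-/ᵉ-inverse x@(mkℚ -[1+ _ ] _ _) -∞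
  rewrite neg⊛-∞ (1/ x) {{1/neg⇒neg x}} = neg⊛+∞ x

module _ {fmt : Format} where

  fpInterval⊆F̄ : ∀ {Z} → IsFPInterval fmt Z → ∀ {w} → Z w → InF̄ fmt w
  fpInterval⊆F̄ (_ , _ , Z≡X∩F̄) Zw = proj₂ (proj₁ (Z≡X∩F̄ _) Zw)

  fpInterval-convex : ∀ {Z} → IsFPInterval fmt Z → ∀ {a b c} →
    Z a → Z c → InF̄ fmt b → Between a b c → Z b
  fpInterval-convex {Z} (X , X-interval , Z≡X∩F̄) {a} {b} {c} Za Zc Fb a-b-c =
    proj₂ (Z≡X∩F̄ b) (Xb a-b-c , Fb)
    where
    X⊇Z : ∀ {w} → Z w → X w
    X⊇Z Zw = proj₁ (proj₁ (Z≡X∩F̄ _) Zw)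

    Xb : Between a b c → X b
    Xb (inj₁ (a≤b , b≤c)) = X-interval a b c (X⊇Z Za) (X⊇Z Zc) a≤b b≤c
    Xb (inj₂ (c≤b , b≤a)) = X-interval c b a (X⊇Z Zc) (X⊇Z Za) c≤b b≤a

module _ {fmt : Format} {fl : ℚ̄ → ℚ̄} (rounding : IsRounding fmt fl) where
  open IsRounding rounding

  fl-∈F̄ : ∀ a → InF̄ fmt (fl a)
  fl-∈F̄ a with rd-or-ru a
  ... | inj₁ (F̄-fl , _) = F̄-fl
  ... | inj₂ (F̄-fl , _) = F̄-fl

  fl-fixes-F̄ : ∀ {w} → InF̄ fmt w → fl w ≡ w
  fl-fixes-F̄ {w} F̄w with rd-or-ru w
  ... | inj₁ (_ , fl≤w , rd-max) = ≤ᵉ-antisym fl≤w (rd-max w F̄w ≤ᵉ-refl)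
  ... | inj₂ (_ , w≤fl , ru-min) = ≤ᵉ-antisym (ru-min w F̄w ≤ᵉ-refl) w≤fl

  fl-preserves-Between : ∀ {a b c} → Between a b c → Between (fl a) (fl b) (fl c)
  fl-preserves-Between (inj₁ (a≤b , b≤c)) = inj₁ (mono _ _ a≤b , mono _ _ b≤c)
  fl-preserves-Between (inj₂ (c≤b , b≤a)) = inj₂ (mono _ _ c≤b , mono _ _ b≤a)

  infix 7 _⊗′_

  _⊗′_ : ℚ → ℚ̄ → ℚ̄
  _⊗′_ = _⊗_ fmt fl

  RD∨RU⇒feasible : ∀ {x Z d u} → InF̄ fmt d → InF̄ fmt u →
    Z (x ⊗′ d) ⊎ Z (x ⊗′ u) → Feasible fmt fl x Z
  RD∨RU⇒feasible F̄d _ (inj₁ Zx⊗d) = _ , Zx⊗d , _ , F̄d , refl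
  RD∨RU⇒feasible _ F̄u (inj₂ Zx⊗u) = _ , Zx⊗u , _ , F̄u , refl

  module _ (x : ℚ) .{{_ : NonZero x}} where

    ⊗-preserves-Between : ∀ {a b c} → a ≤ᵉ b → b ≤ᵉ c →
      Between (x ⊗′ a) (x ⊗′ b) (x ⊗′ c)
    ⊗-preserves-Between a≤b b≤c = fl-preserves-Between (⊛-preserves-Between x a≤b b≤c)

    ⊗-/ᵉ-inverse : ∀ {z} → InF̄ fmt z → x ⊗′ (z /ᵉ x) ≡ z
    ⊗-/ᵉ-inverse {z} F̄z = trans (cong fl (⊛-/ᵉ-inverse x z)) (fl-fixes-F̄ F̄z)

    module _ {Z : ℚ̄ → Set} (Z-fp : IsFPInterval fmt Z) {z : ℚ̄} (Zz : Z z) where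

      Z-x⊗z/x : Z (x ⊗′ (z /ᵉ x))
      Z-x⊗z/x = subst Z (sym (⊗-/ᵉ-inverse (fpInterval⊆F̄ Z-fp Zz))) Zz

      feasible⇒RD∨RU : ∀ {d u} → IsRD fmt (z /ᵉ x) d → IsRU fmt (z /ᵉ x) u →
        Feasible fmt fl x Z → Z (x ⊗′ d) ⊎ Z (x ⊗′ u)
      feasible⇒RD∨RU (_ , d≤z/x , rd-max) (_ , z/x≤u , ru-min) (_ , Zxy , y , F̄y , refl)
        with ≤ᵉ-total y (z /ᵉ x)
      ... | inj₁ y≤z/x = inj₁ (fpInterval-convex Z-fp Zxy Z-x⊗z/x (fl-∈F̄ _)
                          (⊗-preserves-Between (rd-max y F̄y y≤z/x) d≤z/x))
      ... | inj₂ z/x≤y = inj₂ (fpInterval-convex Z-fp Z-x⊗z/x Zxy (fl-∈F̄ _)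
                          (⊗-preserves-Between z/x≤u (ru-min y F̄y z/x≤y)))

mainTheorem9 : (fmt : Format) (fl : ℚ̄ → ℚ̄) → IsRounding fmt fl →
    (x : ℚ) → .{{_ : NonZero x}} → InF* fmt x →
    (Z : ℚ̄ → Set) → IsFPInterval fmt Z →
    (z : ℚ̄) → Z z →
    (d u : ℚ̄) → IsRD fmt (z /ᵉ x) d → IsRU fmt (z /ᵉ x) u →
    (Feasible fmt fl x Z → Z (_⊗_ fmt fl x d) ⊎ Z (_⊗_ fmt fl x u)) ×
    (Z (_⊗_ fmt fl x d) ⊎ Z (_⊗_ fmt fl x u) → Feasible fmt fl x Z)
mainTheorem9 fmt fl rounding x _ Z Z-fp z Zz d u rd@(F̄d , _) ru@(F̄u , _) =
  feasible⇒RD∨RU rounding x Z-fp Zz rd ru , RD∨RU⇒feasible rounding F̄d F̄u
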